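{- Let $\Sigma$ be a signed simple quartic (4-regular) graph in which every vertex $v$ has negative degree $d^-(v)\le 2$. If $\Sigma$ has a fully negative circle $C$ with a chord $xy$, then $\Sigma^{\{x,y\}}$ has strictly fewer fully negative circles than $\Sigma$; in particular, $C$ is not fully negative in $\Sigma^{\{x,y\}}$.
   Context: A signed graph is a pair $\Sigma=(\Gamma,\sigma)$ with $\sigma: E(\Gamma)\to\{+,-\}$. $d^-(v)$ is the number of negative edges at $v$. For $X\subseteq V(\Sigma)$, $\Sigma^X$ is obtained by switching $X$, i.e., negating every edge with exactly one end in $X$. A circle (cycle) is fully negative if all its edges are negative. A chord of a circle $C$ is an edge not in $C$ joining two vertices of $C$. -}

module Defs where

open import Data.Nat using (ℕ; zero; suc; _+_; _≤_)
open import Data.Fin using (Fin; zero; suc; _≟_; toℕ)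
open import Data.Nat.DivMod using (_mod_)
open import Data.Bool using (Bool; true; false; _∨_; _∧_; _xor_; if_then_else_)
open import Data.Product using (Σ; ∃; _×_; _,_; proj₁)
open import Data.Sum using (_⊎_)
open import Data.Empty using (⊥)
open import Relation.Nullary using (¬_)
open import Relation.Nullary.Decidable using (⌊_⌋)
open import Relation.Binary.PropositionalEquality using (_≡_; _≢_)
open import Function.Definitions using (Injective)

data Sign : Set where
  plus minus : Sign

flipSign : Sign → Sign
flipSign plus  = minus
flipSign minus = plus

isNeg : Sign → Bool
isNeg plus  = false
isNeg minus = true

countTrue : ∀ {n} → (Fin n → Bool) → ℕ
countTrue {zero}  p = 0
countTrue {suc n} p = (if p zero then 1 else 0) + countTrue (λ i → p (suc i))

record SimpleGraph (n : ℕ) : Set where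
  field
    adj     : Fin n → Fin n → Bool
    adjSym  : ∀ a b → adj a b ≡ adj b a
    adjIrr  : ∀ a → adj a a ≡ false
open SimpleGraph public

-- A signed simple graph: underlying simple graph plus a symmetric sign
-- function (only its values on edges matter).
record SignedGraph (n : ℕ) : Set where
  field
    graph   : SimpleGraph n
    sign    : Fin n → Fin n → Sign
    signSym : ∀ a b → sign a b ≡ sign b a
open SignedGraph public

deg : ∀ {n} → SimpleGraph n → Fin n → ℕ
deg Γ a = countTrue (λ b → adj Γ a b)

negDeg : ∀ {n} → SignedGraph n → Fin n → ℕ
negDeg Σg a = countTrue (λ b → adj (graph Σg) a b ∧ isNeg (sign Σg a b))

Quartic : ∀ {n} → SimpleGraph n → Set
Quartic Γ = ∀ a → deg Γ a ≡ 4

switch : ∀ {n} → SignedGraph n → (Fin n → Bool) → SignedGraph n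
switch Σg X = record
  { graph   = graph Σg
  ; sign    = λ a b → if X a xor X b then flipSign (sign Σg a b) else sign Σg a b
  ; signSym = sym'
  }
  where
  open import Relation.Binary.PropositionalEquality using (refl; cong₂)
  xor-comm : ∀ p q → p xor q ≡ q xor p
  xor-comm false false = refl
  xor-comm false true  = refl
  xor-comm true  false = refl
  xor-comm true  true  = refl
  sym' : ∀ a b → (if X a xor X b then flipSign (sign Σg a b) else sign Σg a b)
               ≡ (if X b xor X a then flipSign (sign Σg b a) else sign Σg b a)
  sym' a b with X a | X b | sign Σg a b | sign Σg b a | signSym Σg a b
  ... | false | false | s | .s | refl = refl
  ... | false | true  | s | .s | refl = refl
  ... | true  | false | s | .s | refl = refl
  ... | true  | true  | s | .s | refl = refl

pair : ∀ {n} → Fin n → Fin n → Fin n → Bool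
pair x y v = ⌊ v ≟ x ⌋ ∨ ⌊ v ≟ y ⌋

-- Edge sets (sets of unordered vertex pairs, as a relation on vertices).
EdgeSet : ℕ → Set
EdgeSet n = Fin n → Fin n → Bool

_≈ₑ_ : ∀ {n} → EdgeSet n → EdgeSet n → Set
E ≈ₑ F = ∀ a b → E a b ≡ F a b

next : ∀ {k} → Fin (suc k) → Fin (suc k)
next {k} i = (suc (toℕ i)) mod (suc k)

-- An edge set C is (the edge set of) a circle of the simple graph Γ:
-- there is a cyclic sequence v₀,…,v_{k-1} of k ≥ 3 distinct vertices such that
-- the edges of C are exactly the pairs {vᵢ, v_{i+1 mod k}}, and these are edges of Γ.
IsCircle : ∀ {n} → SimpleGraph n → EdgeSet n → Set
IsCircle {n} Γ C =
  Σ ℕ λ k → (3 ≤ suc k) × Σ (Fin (suc k) → Fin n) λ v →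
    Injective _≡_ _≡_ v ×
    (∀ a b → C a b ≡ true →
       Σ (Fin (suc k)) λ t → (a ≡ v t × b ≡ v (next t)) ⊎ (b ≡ v t × a ≡ v (next t))) ×
    (∀ a b (t : Fin (suc k)) → (a ≡ v t × b ≡ v (next t)) ⊎ (b ≡ v t × a ≡ v (next t)) →
       C a b ≡ true) ×
    (∀ a b → C a b ≡ true → adj Γ a b ≡ true)

IsFullyNegCircle : ∀ {n} → SignedGraph n → EdgeSet n → Set
IsFullyNegCircle Σg C =
  IsCircle (graph Σg) C × (∀ a b → C a b ≡ true → sign Σg a b ≡ minus)

-- The type of fully negative circles of Σ (compared up to ≈ₑ of edge sets).
FNCircle : ∀ {n} → SignedGraph n → Set
FNCircle {n} Σg = Σ (EdgeSet n) (IsFullyNegCircle Σg)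

-- "A has strictly fewer elements than B" for the (finite) sets of fully negative
-- circles: an injection (w.r.t. equality of edge sets) that misses some element.
StrictlyFewerFNC : ∀ {n} → SignedGraph n → SignedGraph n → Set
StrictlyFewerFNC Σ₁ Σ₂ =
  Σ (FNCircle Σ₁ → FNCircle Σ₂) λ f →
    (∀ c d → proj₁ (f c) ≈ₑ proj₁ (f d) → proj₁ c ≈ₑ proj₁ d) ×
    Σ (FNCircle Σ₂) λ e → ∀ c → ¬ (proj₁ (f c) ≈ₑ proj₁ e)

OnCircle : ∀ {n} → EdgeSet n → Fin n → Set
OnCircle C x = ∃ λ z → C x z ≡ true

IsChord : ∀ {n} → SimpleGraph n → EdgeSet n → Fin n → Fin n → Set
IsChord Γ C x y = adj Γ x y ≡ true × C x y ≡ false × OnCircle C x × OnCircle C y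

-- The two negative circle edges at x exhaust d⁻(x) ≤ 2, so the chord xy is positive, and
-- it stays positive after switching {x, y}, while the two circle edges at x become positive.
-- A fully negative circle of Σ^{x,y} through x would then need two further neighbours of x,
-- five in all, which a quartic graph does not allow; likewise for y. Hence the fully negative
-- circles of Σ^{x,y} avoid x and y, so switching does not touch their signs and they are
-- fully negative in Σ as well, whereas C itself passes through x.
module Submission where

open import Defs
open import Data.Nat using (zero; suc; _+_; _≤_; _<_; _<?_; _%_; z≤n; s≤s)
open import Data.Nat.Properties
  using (+-suc; ≤-antisym; ≮⇒≥; ≤-reflexive; ≤-trans; <⇒≱; <-irrefl; m+1+n≢n)
open import Data.Nat.DivMod using (m<n⇒m%n≡m; n%n≡0)
open import Data.Fin using (Fin; zero; suc; toℕ; fromℕ; inject₁; _≟_)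
open import Data.Fin.Properties
  using (toℕ-injective; toℕ-fromℕ; toℕ-fromℕ<; toℕ-inject₁; toℕ<n; toℕ≤pred[n])
open import Data.Vec.Functional using (updateAt)
open import Data.Vec.Functional.Properties using (updateAt-minimal)
open import Data.Bool using (Bool; true; false; _∧_; if_then_else_)
open import Data.Bool.Properties using (∨-zeroʳ)
open import Data.List using (List; []; _∷_; length)
open import Data.List.Relation.Unary.All as All using (All; []; _∷_)
open import Data.List.Relation.Unary.AllPairs using ([]; _∷_)
open import Data.List.Relation.Unary.Unique.Propositional using (Unique)
open import Data.Product using (_×_; _,_; proj₁; proj₂; ∃; ∃₂)
open import Data.Sum using (_⊎_; inj₁; inj₂)
open import Data.Empty using (⊥-elim)
open import Function using (const; id; _∘_)
open import Relation.Nullary using (¬_; yes; no)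
open import Relation.Binary.PropositionalEquality

countTrue-updateAt-false : ∀ {n} (p : Fin n → Bool) (a : Fin n) → p a ≡ true →
                           countTrue p ≡ suc (countTrue (updateAt p a (const false)))
countTrue-updateAt-false {suc n} p zero    pa rewrite pa = refl
countTrue-updateAt-false {suc n} p (suc a) pa =
  trans (cong ((if p zero then 1 else 0) +_) (countTrue-updateAt-false (p ∘ suc) a pa))
        (+-suc _ _)

length≤countTrue : ∀ {n} (p : Fin n → Bool) {as : List (Fin n)} →
                   Unique as → All (λ a → p a ≡ true) as → length as ≤ countTrue p
length≤countTrue p []                  []         = z≤n
length≤countTrue p (a∉as ∷ as-unique) (pa ∷ pas)
  rewrite countTrue-updateAt-false p _ pa =
  s≤s (length≤countTrue (updateAt p _ (const false)) as-unique
         (All.zipWith (λ (a≢b , pb) → trans (updateAt-minimal _ _ p (a≢b ∘ sym)) pb) (a∉as , pas)))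

next-toℕ : ∀ {k} (i : Fin (suc k)) →
           (toℕ i < k × toℕ (next i) ≡ suc (toℕ i)) ⊎ (toℕ i ≡ k × toℕ (next i) ≡ 0)
next-toℕ {k} i with toℕ i <? k
... | yes i<k = inj₁ (i<k , trans (toℕ-fromℕ< _) (m<n⇒m%n≡m (s≤s i<k)))
... | no  i≮k =
  inj₂ (i≡k , trans (toℕ-fromℕ< _) (trans (cong (λ m → suc m % suc k) i≡k) (n%n≡0 (suc k))))
  where
  i≡k : toℕ i ≡ k
  i≡k = ≤-antisym (toℕ≤pred[n] i) (≮⇒≥ i≮k)

next-surjective : ∀ {k} (t : Fin (suc k)) → ∃ λ s → next s ≡ t
next-surjective {k} zero with next-toℕ (fromℕ k)
... | inj₁ (k<k , _) = ⊥-elim (<-irrefl (toℕ-fromℕ k) k<k)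
... | inj₂ (_ , e)   = fromℕ k , toℕ-injective e
next-surjective {k} (suc t) with next-toℕ (inject₁ t)
... | inj₁ (_ , e) = inject₁ t , toℕ-injective (trans e (cong suc (toℕ-inject₁ t)))
... | inj₂ (e , _) = ⊥-elim (<-irrefl e (subst (_< k) (sym (toℕ-inject₁ t)) (toℕ<n t)))

next∘next≢id : ∀ {k} → 2 ≤ k → (s : Fin (suc k)) → next (next s) ≢ s
next∘next≢id {k} 2≤k s e with next-toℕ s | next-toℕ (next s)
... | inj₁ (_ , e₁) | inj₁ (_ , e₂) = m+1+n≢n 1 (trans (sym (trans e₂ (cong suc e₁))) (cong toℕ e))
... | inj₁ (_ , e₁) | inj₂ (e₂ , e₃) =
  <⇒≱ 2≤k (≤-reflexive (trans (sym e₂) (trans e₁ (cong suc (trans (sym (cong toℕ e)) e₃)))))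
... | inj₂ (e₁ , e₂) | inj₁ (_ , e₃) =
  <⇒≱ 2≤k (≤-reflexive (trans (sym e₁) (trans (sym (cong toℕ e)) (trans e₃ (cong suc e₂)))))
... | inj₂ (_ , e₁) | inj₂ (e₂ , _) = <⇒≱ 2≤k (≤-trans (≤-reflexive (trans (sym e₂) e₁)) z≤n)

module _ {n} {Γ : SimpleGraph n} {C : EdgeSet n} where

  circle-adj : IsCircle Γ C → ∀ {a b} → C a b ≡ true → adj Γ a b ≡ true
  circle-adj (_ , _ , _ , _ , _ , _ , edge⇒adj) = edge⇒adj _ _

  circle-edge-sym : IsCircle Γ C → ∀ {a b} → C a b ≡ true → C b a ≡ true
  circle-edge-sym (_ , _ , _ , _ , edge⇒step , step⇒edge , _) {a} {b} ab∈C
    with edge⇒step a b ab∈C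
  ... | t , inj₁ step = step⇒edge b a t (inj₂ step)
  ... | t , inj₂ step = step⇒edge b a t (inj₁ step)

  circle-sym : IsCircle Γ C → ∀ a b → C a b ≡ C b a
  circle-sym circle a b with C a b in ab | C b a in ba
  ... | true  | true  = refl
  ... | false | false = refl
  ... | true  | false = trans (sym (circle-edge-sym circle ab)) ba
  ... | false | true  = trans (sym ab) (circle-edge-sym circle ba)

  circle-two-neighbours : IsCircle Γ C → ∀ {x} → OnCircle C x →
                          ∃₂ λ z₁ z₂ → z₁ ≢ z₂ × C x z₁ ≡ true × C x z₂ ≡ true
  circle-two-neighbours (_ , s≤s 2≤k , v , v-inj , edge⇒step , step⇒edge , _) {x} (z , xz∈C) =
    neighbours-at (proj₁ position) (proj₂ position)
    where
    position : ∃ λ t → x ≡ v t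
    position with edge⇒step x z xz∈C
    ... | t , inj₁ (x≡vt , _) = t , x≡vt
    ... | t , inj₂ (_ , x≡vt) = next t , x≡vt
    neighbours-at : ∀ t → x ≡ v t → ∃₂ λ z₁ z₂ → z₁ ≢ z₂ × C x z₁ ≡ true × C x z₂ ≡ true
    neighbours-at t x≡vt with next-surjective t
    ... | s , s↦t =
      v (next t) , v s ,
      (λ e → next∘next≢id 2≤k s (trans (cong next s↦t) (v-inj e))) ,
      step⇒edge x _ t (inj₁ (x≡vt , refl)) ,
      step⇒edge x _ s (inj₂ (refl , trans x≡vt (cong v (sym s↦t))))

adj⇒≢ : ∀ {n} (Γ : SimpleGraph n) {a b} → adj Γ a b ≡ true → a ≢ b
adj⇒≢ Γ {a} a~a refl with trans (sym a~a) (adjIrr Γ a)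
... | ()

SignedEdge : ∀ {n} → SignedGraph n → Sign → Fin n → Fin n → Set
SignedEdge Σg s a b = adj (graph Σg) a b ≡ true × sign Σg a b ≡ s

module _ {n} (Σg : SignedGraph n) where

  fullyNeg-edge : ∀ {D} → IsFullyNegCircle Σg D → ∀ {a b} → D a b ≡ true → SignedEdge Σg minus a b
  fullyNeg-edge (D-circle , D-neg) ab∈D = circle-adj {Γ = graph Σg} D-circle ab∈D , D-neg _ _ ab∈D

  signedEdge-≢ : ∀ {x a b} → SignedEdge Σg plus x a → SignedEdge Σg minus x b → b ≢ a
  signedEdge-≢ (_ , xa⁺) (_ , xb⁻) refl with trans (sym xa⁺) xb⁻
  ... | ()

  three-positive-edges⇒¬OnFullyNegCircle :
    ∀ {x a b c D} → deg (graph Σg) x ≤ 4 →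
    SignedEdge Σg plus x a → SignedEdge Σg plus x b → SignedEdge Σg plus x c →
    a ≢ b → a ≢ c → b ≢ c → IsFullyNegCircle Σg D → ¬ OnCircle D x
  three-positive-edges⇒¬OnFullyNegCircle {x} deg≤4 xa xb xc a≢b a≢c b≢c D-fn x∈D
    with circle-two-neighbours {Γ = graph Σg} (proj₁ D-fn) x∈D
  ... | w₁ , w₂ , w₁≢w₂ , xw₁∈D , xw₂∈D = <⇒≱ five≤deg deg≤4
    where
    xw₁ = fullyNeg-edge D-fn xw₁∈D
    xw₂ = fullyNeg-edge D-fn xw₂∈D
    five≤deg : 5 ≤ deg (graph Σg) x
    five≤deg = length≤countTrue (adj (graph Σg) x)
      ((w₁≢w₂ ∷ signedEdge-≢ xa xw₁ ∷ signedEdge-≢ xb xw₁ ∷ signedEdge-≢ xc xw₁ ∷ []) ∷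
       (signedEdge-≢ xa xw₂ ∷ signedEdge-≢ xb xw₂ ∷ signedEdge-≢ xc xw₂ ∷ []) ∷
       (a≢b ∷ a≢c ∷ []) ∷ (b≢c ∷ []) ∷ [] ∷ [])
      (proj₁ xw₁ ∷ proj₁ xw₂ ∷ proj₁ xa ∷ proj₁ xb ∷ proj₁ xc ∷ [])

  two-negative-edges⇒positive :
    ∀ {x a b c} → negDeg Σg x ≤ 2 →
    SignedEdge Σg minus x a → SignedEdge Σg minus x b → adj (graph Σg) x c ≡ true →
    a ≢ b → a ≢ c → b ≢ c → sign Σg x c ≡ plus
  two-negative-edges⇒positive {x} {c = c} d⁻≤2 xa xb x~c a≢b a≢c b≢c with sign Σg x c in xc-sign
  ... | plus  = refl
  ... | minus = ⊥-elim (<⇒≱ three≤d⁻ d⁻≤2)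
    where
    negative-at-x : Fin n → Bool
    negative-at-x d = adj (graph Σg) x d ∧ isNeg (sign Σg x d)
    counted : ∀ {d} → SignedEdge Σg minus x d → negative-at-x d ≡ true
    counted (x~d , xd⁻) rewrite x~d | xd⁻ = refl
    three≤d⁻ : 3 ≤ negDeg Σg x
    three≤d⁻ = length≤countTrue negative-at-x
      ((a≢b ∷ a≢c ∷ []) ∷ (b≢c ∷ []) ∷ [] ∷ [])
      (counted xa ∷ counted xb ∷ counted (x~c , xc-sign) ∷ [])

module _ {n} (Σg : SignedGraph n) (X : Fin n → Bool) where

  switch-sign-≡ : ∀ {a b} → X a ≡ X b → sign (switch Σg X) a b ≡ sign Σg a b
  switch-sign-≡ {a} {b} Xa≡Xb rewrite Xa≡Xb with X b
  ... | true  = refl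
  ... | false = refl

  switch-sign-flip : ∀ {a b} → X a ≡ true → X b ≡ false →
                     sign (switch Σg X) a b ≡ flipSign (sign Σg a b)
  switch-sign-flip Xa Xb rewrite Xa | Xb = refl

  switch-fullyNeg-outside : ∀ {D} → IsFullyNegCircle (switch Σg X) D →
                            (∀ a → OnCircle D a → X a ≡ false) → IsFullyNegCircle Σg D
  switch-fullyNeg-outside {D} (D-circle , D-neg) outside = D-circle , unswitched
    where
    unswitched : ∀ a b → D a b ≡ true → sign Σg a b ≡ minus
    unswitched a b ab∈D = trans (sym (switch-sign-≡ (trans (outside a (b , ab∈D)) (sym b-outside))))
                                (D-neg a b ab∈D)
      where
      b-outside : X b ≡ false
      b-outside = outside b (a , circle-edge-sym {Γ = graph Σg} D-circle ab∈D)

  chord-end-avoids-fullyNeg :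
    ∀ {C x y} → deg (graph Σg) x ≤ 4 → negDeg Σg x ≤ 2 → IsFullyNegCircle Σg C →
    adj (graph Σg) x y ≡ true → C x y ≡ false → OnCircle C x →
    X x ≡ true → X y ≡ true → (∀ u → u ≢ x → u ≢ y → X u ≡ false) →
    ∀ {D} → IsFullyNegCircle (switch Σg X) D → ¬ OnCircle D x
  chord-end-avoids-fullyNeg {C} {x} {y} deg≤4 d⁻≤2 C-fn x~y xy∉C x∈C Xx Xy outside
    with circle-two-neighbours {Γ = graph Σg} (proj₁ C-fn) x∈C
  ... | u₁ , u₂ , u₁≢u₂ , xu₁∈C , xu₂∈C =
    three-positive-edges⇒¬OnFullyNegCircle (switch Σg X) deg≤4
      xy⁺ (switched xu₁∈C) (switched xu₂∈C) (y≢ xu₁∈C) (y≢ xu₂∈C) u₁≢u₂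
    where
    y≢ : ∀ {u} → C x u ≡ true → y ≢ u
    y≢ xu∈C refl with trans (sym xu∈C) xy∉C
    ... | ()
    xy⁺ : SignedEdge (switch Σg X) plus x y
    xy⁺ = x~y , trans (switch-sign-≡ (trans Xx (sym Xy)))
                      (two-negative-edges⇒positive Σg d⁻≤2
                         (fullyNeg-edge Σg C-fn xu₁∈C) (fullyNeg-edge Σg C-fn xu₂∈C)
                         x~y u₁≢u₂ (y≢ xu₁∈C ∘ sym) (y≢ xu₂∈C ∘ sym))
    switched : ∀ {u} → C x u ≡ true → SignedEdge (switch Σg X) plus x u
    switched {u} xu∈C with fullyNeg-edge Σg C-fn xu∈C
    ... | x~u , xu⁻ =
      x~u , trans (switch-sign-flip Xx (outside u (adj⇒≢ (graph Σg) x~u ∘ sym) (y≢ xu∈C ∘ sym)))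
                  (cong flipSign xu⁻)

module _ {n} (x y : Fin n) where

  pair-left : pair x y x ≡ true
  pair-left with x ≟ x
  ... | yes _   = refl
  ... | no  x≢x = ⊥-elim (x≢x refl)

  pair-right : pair x y y ≡ true
  pair-right with y ≟ y
  ... | yes _   = ∨-zeroʳ _
  ... | no  y≢y = ⊥-elim (y≢y refl)

  pair-outside : ∀ u → u ≢ x → u ≢ y → pair x y u ≡ false
  pair-outside u u≢x u≢y with u ≟ x | u ≟ y
  ... | yes u≡x | _       = ⊥-elim (u≢x u≡x)
  ... | no _    | yes u≡y = ⊥-elim (u≢y u≡y)
  ... | no _    | no _    = refl

lemma4p5 : ∀ {n} (Σg : SignedGraph n) → Quartic (graph Σg) →
           (∀ v → negDeg Σg v ≤ 2) →
           (C : EdgeSet n) → IsFullyNegCircle Σg C →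
           (x y : Fin n) → IsChord (graph Σg) C x y →
           StrictlyFewerFNC (switch Σg (pair x y)) Σg
           × ¬ IsFullyNegCircle (switch Σg (pair x y)) C
lemma4p5 Σg quartic d⁻≤2 C C-fn x y (x~y , xy∉C , x∈C , y∈C) =
  (forget , (λ _ _ → id) , (C , C-fn) , misses-C) , λ C-fn′ → avoids-x C-fn′ x∈C
  where
  X = pair x y
  avoids-x = chord-end-avoids-fullyNeg Σg X (≤-reflexive (quartic x)) (d⁻≤2 x) C-fn x~y xy∉C x∈C
               (pair-left x y) (pair-right x y) (pair-outside x y)
  avoids-y = chord-end-avoids-fullyNeg Σg X (≤-reflexive (quartic y)) (d⁻≤2 y) C-fn
               (trans (adjSym (graph Σg) y x) x~y)
               (trans (circle-sym {Γ = graph Σg} (proj₁ C-fn) y x) xy∉C) y∈C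
               (pair-right x y) (pair-left x y) (λ u u≢y u≢x → pair-outside x y u u≢x u≢y)
  forget : FNCircle (switch Σg X) → FNCircle Σg
  forget (D , D-fn) = D , switch-fullyNeg-outside Σg X D-fn λ a a∈D →
    pair-outside x y a (λ { refl → avoids-x D-fn a∈D }) (λ { refl → avoids-y D-fn a∈D })
  misses-C : ∀ c → ¬ (proj₁ (forget c) ≈ₑ C)
  misses-C (D , D-fn) D≈C = avoids-x D-fn (proj₁ x∈C , trans (D≈C x _) (proj₂ x∈C))
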